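{- Let $G$ and $G'$ be non-isomorphic triconnected planar graphs, $G$ with $n$ vertices, $C$ a collocated configuration in $G$ and $C'$ a twisted configuration in $G'$. Consider a position of the Ehrenfeucht–Fraïssé game in which the vertices of $C$ and $C'$ with the same label are covered by the same pebble, and additionally $s,t,a\in V(G)$ and $s',t',a'\in V(G')$ are pebbled correspondingly, with $d_0(s,t)=d_0(s',t')$ and such that either $a\in S_0(s,t)$ and $a'\notin S_0(s',t')$, or $a\notin S_0(s,t)$ and $a'\in S_0(s',t')$. Then from this position Spoiler wins with 9 pebbles in at most $\log_2 n+2$ rounds.
   Context: An $X$-configuration is a set of 5 pairwise distinct vertices labelled $x,y,u,v,w$ with $x,y,u,v$ adjacent to $w$; an $H$-configuration is a set of 6 pairwise distinct vertices labelled $x,y,z,u,v,w$ with $z$ adjacent to $w$, $x,y$ adjacent to $z$, $u,v$ adjacent to $w$; for an $X$-configuration set $z=w$. In a triconnected planar graph (unique spherical embedding up to equivalence by Whitney's theorem), an $X$-configuration is collocated if $u,x,y,v$ occur around $w$ in this cyclic order (up to cyclic shift and reversal); an $H$-configuration is collocated if $x,z,w,u$ and $y,z,w,v$ are segments of the two facial cycles containing the edge $zw$. A twisted configuration is obtained from a collocated one by swapping labels $x$ and $y$. A path avoids $C$ if none of its non-endpoint vertices lies in $C$; $d_0(a,b)$ (in $G$, w.r.t. $C$; in $G'$, w.r.t. $C'$) is the minimum length of an $a$-$b$-path avoiding the configuration, and $S_0(a,b)$ is the set of vertices lying on at least one $a$-$b$-path avoiding the configuration of length $d_0(a,b)$.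 Game: each pebble has two copies; in each round Spoiler places (possibly moves) a copy of some pebble on a vertex of one graph and Duplicator places the other copy in the other graph; Duplicator wins as long as the correspondence between vertices carrying the same pebble is a partial isomorphism (respects equality and adjacency); Spoiler wins within $r$ rounds if he can force failure within $r$ rounds against any Duplicator strategy. -}

module Defs where

open import Data.Nat using (ℕ; zero; suc; _+_; _*_; _≤_; _<_; _≤ᵇ_)
open import Data.Nat.Logarithm using (⌊log₂_⌋)
open import Data.Bool using (Bool; true; false; _∧_)
open import Data.Fin using (Fin; toℕ)
open import Data.List using (List; []; _∷_; length; allFin; cartesianProduct; filterᵇ; upTo)
open import Data.List.Membership.Propositional using (_∈_; _∉_)
open import Data.List.Relation.Unary.All using (All)
open import Data.List.Relation.Unary.Unique.Propositional using (Unique)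
open import Data.Vec using (Vec; lookup) renaming (_∷_ to _∷ᵥ_; [] to []ᵥ)
open import Data.Maybe using (Maybe; just; nothing)
open import Data.Product using (Σ; ∃; _×_; _,_; proj₁; proj₂)
open import Data.Sum using (_⊎_)
open import Relation.Nullary using (¬_)
open import Relation.Binary.PropositionalEquality using (_≡_; _≢_)
open import Function.Bundles using (_↔_; Inverse)

record Graph : Set where
  field
    n       : ℕ
    adj     : Fin n → Fin n → Bool
    adj-sym : ∀ u v → adj u v ≡ adj v u
    adj-irr : ∀ v → adj v v ≡ false

open Graph public

V : Graph → Set
V G = Fin (n G)

Edge : (G : Graph) → V G → V G → Set
Edge G u v = adj G u v ≡ true

Iso : Graph → Graph → Set
Iso G H = Σ (V G ↔ V H) λ f →
  ∀ u v → adj H (Inverse.to f u) (Inverse.to f v) ≡ adj G u v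

data Walk (G : Graph) : V G → V G → Set where
  stop : (a : V G) → Walk G a a
  step : (a : V G) {b c : V G} → Edge G a b → Walk G b c → Walk G a c

verts : ∀ {G a b} → Walk G a b → List (V G)
verts (stop a) = a ∷ []
verts (step a e w) = a ∷ verts w

len : ∀ {G a b} → Walk G a b → ℕ
len (stop a) = 0
len (step a e w) = suc (len w)

inner : ∀ {G a b} → Walk G a b → List (V G)
inner (stop a) = []
inner (step a e (stop b)) = []
inner (step a e (step b e' w)) = b ∷ inner (step b e' w)

IsPath : ∀ {G a b} → Walk G a b → Set
IsPath w = Unique (verts w)

Connected : Graph → Set
Connected G = ∀ (a b : V G) → Walk G a b

-- 3-connected: at least 4 vertices, connected, and stays connected
-- after deleting any one or two vertices p, q (p ≡ q allowed)
Triconnected : Graph → Set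
Triconnected G =
  (4 ≤ n G) × Connected G ×
  (∀ (p q a b : V G) → a ≢ p → a ≢ q → b ≢ p → b ≢ q →
     Σ (Walk G a b) λ w → All (λ c → c ≢ p × c ≢ q) (verts w))

allᵇ : ∀ {A : Set} → (A → Bool) → List A → Bool
allᵇ p [] = true
allᵇ p (x ∷ xs) = p x ∧ allᵇ p xs

iter : ∀ {A : Set} → (A → A) → ℕ → A → A
iter f zero a = a
iter f (suc k) a = f (iter f k a)

-- rot v is the cyclic successor map on the neighbours of v
Rotation : Graph → Set
Rotation G = V G → V G → V G

IsRotation : (G : Graph) → Rotation G → Set
IsRotation G ρ =
  (∀ v w → Edge G v w → Edge G v (ρ v w)) ×
  (∀ v w w' → Edge G v w → Edge G v w' → ρ v w ≡ ρ v w' → w ≡ w') ×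
  (∀ v w w' → Edge G v w → Edge G v w' → ∃ λ k → iter (ρ v) k w ≡ w')

Dart : Graph → Set
Dart G = V G × V G

-- face-tracing permutation on darts: arriving at b from a, continue
-- along the successor of a in the rotation at b
φ : (G : Graph) → Rotation G → Dart G → Dart G
φ G ρ (a , b) = (b , ρ b a)

darts : (G : Graph) → List (Dart G)
darts G = filterᵇ (λ d → adj G (proj₁ d) (proj₂ d))
                  (cartesianProduct (allFin (n G)) (allFin (n G)))

numDarts : Graph → ℕ
numDarts G = length (darts G)

key : (G : Graph) → Dart G → ℕ
key G (a , b) = toℕ a * n G + toℕ b

-- number of faces = number of φ-orbits on darts (count orbit minima)
numFaces : (G : Graph) → Rotation G → ℕ
numFaces G ρ = length (filterᵇ isMin (darts G))
  where
  isMin : Dart G → Bool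
  isMin d = allᵇ (λ k → key G d ≤ᵇ key G (iter (φ G ρ) k d)) (upTo (numDarts G))

-- planar (spherical) embedding: Euler's formula V - E + F = 2,
-- written as 2V + 2F = 4 + (number of darts) since #darts = 2E
IsPlanarEmbedding : (G : Graph) → Rotation G → Set
IsPlanarEmbedding G ρ =
  IsRotation G ρ × (2 * n G + 2 * numFaces G ρ ≡ 4 + numDarts G)

Planar : Graph → Set
Planar G = Σ (Rotation G) (IsPlanarEmbedding G)

record Config (G : Graph) : Set where
  constructor conf
  field
    x y z u v w : V G

open Config public

confVerts : ∀ {G} → Config G → List (V G)
confVerts C = x C ∷ y C ∷ z C ∷ u C ∷ v C ∷ w C ∷ []

IsXConf : (G : Graph) → Config G → Set
IsXConf G C =
  z C ≡ w C ×
  Unique (x C ∷ y C ∷ u C ∷ v C ∷ w C ∷ []) ×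
  Edge G (x C) (w C) × Edge G (y C) (w C) ×
  Edge G (u C) (w C) × Edge G (v C) (w C)

IsHConf : (G : Graph) → Config G → Set
IsHConf G C =
  Unique (x C ∷ y C ∷ z C ∷ u C ∷ v C ∷ w C ∷ []) ×
  Edge G (z C) (w C) ×
  Edge G (x C) (z C) × Edge G (y C) (z C) ×
  Edge G (u C) (w C) × Edge G (v C) (w C)

-- a, b, c, d occur in this cyclic order in the cyclic permutation σ
-- (starting from a, without wrapping around)
CycOrder4 : ∀ {A : Set} → (A → A) → A → A → A → A → Set
CycOrder4 σ a b c d =
  Σ ℕ λ i → Σ ℕ λ j → Σ ℕ λ k →
    (0 < i) × (i < j) × (j < k) ×
    (iter σ i a ≡ b) × (iter σ j a ≡ c) × (iter σ k a ≡ d) ×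
    (∀ m → 0 < m → m ≤ k → iter σ m a ≢ a)

-- a,b,c,d is a segment (in either direction) of a facial cycle
Segment : (G : Graph) → Rotation G → V G → V G → V G → V G → Set
Segment G ρ a b c d =
  (φ G ρ (a , b) ≡ (b , c) × φ G ρ (b , c) ≡ (c , d)) ⊎
  (φ G ρ (d , c) ≡ (c , b) × φ G ρ (c , b) ≡ (b , a))

Collocated : (G : Graph) → Rotation G → Config G → Set
Collocated G ρ C =
  (IsXConf G C ×
    (CycOrder4 (ρ (w C)) (u C) (x C) (y C) (v C) ⊎
     CycOrder4 (ρ (w C)) (u C) (v C) (y C) (x C))) ⊎
  (IsHConf G C ×
    Segment G ρ (x C) (z C) (w C) (u C) ×
    Segment G ρ (y C) (z C) (w C) (v C))

swapXY : ∀ {G} → Config G → Config G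
swapXY (conf x y z u v w) = conf y x z u v w

Twisted : (G : Graph) → Rotation G → Config G → Set
Twisted G ρ C = Σ (Config G) λ D → Collocated G ρ D × C ≡ swapXY D

AvoidPath : (G : Graph) → Config G → V G → V G → Set
AvoidPath G C a b =
  Σ (Walk G a b) λ p → IsPath p × All (λ c → c ∉ confVerts C) (inner p)

-- d₀(a,b) = d (in particular d₀(a,b) is finite)
D0 : (G : Graph) → Config G → V G → V G → ℕ → Set
D0 G C a b d =
  (Σ (AvoidPath G C a b) λ P → len (proj₁ P) ≡ d) ×
  (∀ (P : AvoidPath G C a b) → d ≤ len (proj₁ P))

InS0 : (G : Graph) → Config G → V G → V G → ℕ → V G → Set
InS0 G C a b d g =
  Σ (AvoidPath G C a b) λ P → len (proj₁ P) ≡ d × g ∈ verts (proj₁ P)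

Position : ℕ → Graph → Graph → Set
Position k G H = Fin k → Maybe (V G × V H)

PartialIso : ∀ {k} (G H : Graph) → Position k G H → Set
PartialIso G H P = ∀ p q g g' h h' →
  P p ≡ just (g , g') → P q ≡ just (h , h') →
  ((g ≡ h → g' ≡ h') × (g' ≡ h' → g ≡ h)) × adj G g h ≡ adj H g' h'

place : ∀ {k G H} → Position k G H → Fin k → V G → V H → Position k G H
place {k} P p g g' q with Data.Fin._≟_ q p
... | Relation.Nullary.yes _ = just (g , g')
... | Relation.Nullary.no  _ = P q

SpoilerWins : ∀ {k} (G H : Graph) → ℕ → Position k G H → Set
SpoilerWins G H zero P = ¬ PartialIso G H P
SpoilerWins {k} G H (suc r) P =
  ¬ PartialIso G H P ⊎
  (Σ (Fin k) λ p →
     (Σ (V G) λ g → ∀ g' → SpoilerWins G H r (place {G = G} {H = H} P p g g')) ⊎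
     (Σ (V H) λ g' → ∀ g → SpoilerWins G H r (place {G = G} {H = H} P p g g')))

startPos : ∀ {G H} → Config G → Config H →
           V G → V G → V G → V H → V H → V H → Position 9 G H
startPos C C' s t a s' t' a' p = lookup
  (just (x C , x C') ∷ᵥ just (y C , y C') ∷ᵥ just (z C , z C') ∷ᵥ
   just (u C , u C') ∷ᵥ just (v C , v C') ∷ᵥ just (w C , w C') ∷ᵥ
   just (s , s') ∷ᵥ just (t , t') ∷ᵥ just (a , a') ∷ᵥ []ᵥ) p

{-# OPTIONS --safe #-}
module Submission where

-- Spoiler plays a halving game on walks avoiding the configuration. Suppose p, q and p', q'
-- carry the same pebbles, G has an avoiding p–q walk of length L ≤ 2^r, and G' has no avoiding
-- p'–q' walk of length ≤ L. If L ≤ 1 the pebbles already violate equality or adjacency.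
-- Otherwise Spoiler pebbles a midpoint c of the walk. Duplicator cannot answer inside C',
-- because the configuration stays pebbled and c, an inner vertex, is not in C; so one of the
-- halves p–c, c–q has no counterpart in G' of at most its length, and Spoiler recurses on it.
-- If a ∈ S₀(s,t) but a' ∉ S₀(s',t'), cut a shortest avoiding s–t path at a. If both halves had
-- counterparts, their concatenation would be an avoiding s'–t' walk through a' of length ≤ d,
-- which by minimality of d is already a path, so a' ∈ S₀(s',t'). Thus one half is unmatched,
-- and its length is at most d < n < 2^(⌊log₂ n⌋+1). The other case is the same game with the
-- graphs swapped.

open import Defs
open import Data.Nat
  using (ℕ; zero; suc; _+_; _*_; _^_; _≤_; _<_; _≤?_; _<?_; z≤n; s≤s; z<s; ⌊_/2⌋; ⌈_/2⌉)
open import Data.Nat.Properties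
  using (≤-refl; ≤-trans; <-≤-trans; ≤-<-trans; <⇒≤; <⇒≱; ≤-antisym; ≮⇒≥; ≰⇒>; 1+n≰n;
         m≤m+n; m≤n+m;
         +-mono-≤; +-identityʳ; +-comm; suc-injective; ^-monoʳ-≤;
         ⌈n/2⌉-mono; n≡⌈n+n/2⌉; ⌊n/2⌋≤⌈n/2⌉; ⌊n/2⌋+⌈n/2⌉≡n; module ≤-Reasoning)
open import Data.Nat.Logarithm using (⌊log₂_⌋; ⌊log₂⌋-mono-≤; ⌊log₂[2^n]⌋≡n)
open import Data.Bool using (true)
import Data.Bool as Bool
open import Data.Fin using (Fin; zero; suc; toℕ; _≟_; #_)
open import Data.Fin.Properties using (any?; pigeonhole)
open import Data.List using (List; []; _∷_; length; lookup)
open import Data.List.Membership.Propositional using (_∈_; _∉_)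
open import Data.List.Membership.Propositional.Properties using (∈-lookup)
open import Data.List.Relation.Unary.Any using (here; there)
open import Data.List.Relation.Unary.All using (All; []; _∷_)
import Data.List.Relation.Unary.All as All
open import Data.List.Relation.Unary.All.Properties using (¬Any⇒All¬)
open import Data.List.Relation.Unary.AllPairs using ([]; _∷_)
open import Data.List.Relation.Unary.Unique.Propositional using (Unique)
open import Data.Maybe using (Maybe; just; nothing)
import Data.Maybe as Maybe
open import Data.Product using (Σ; ∃; ∃₂; _×_; _,_; proj₁; proj₂; swap)
open import Data.Sum using (_⊎_; inj₁; inj₂; [_,_]′)
open import Data.Unit using (⊤; tt)
open import Function using (_∘_)
open import Relation.Nullary using (¬_; Dec; yes; no; contradiction; ¬?)
open import Relation.Nullary.Decidable using (map′; _×-dec_; _⊎-dec_)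
open import Relation.Binary.PropositionalEquality
  using (_≡_; _≢_; refl; sym; trans; cong; subst; _≗_; ≢-sym)

swapPosition : ∀ {k} G H → Position k G H → Position k H G
swapPosition G H P = Maybe.map swap ∘ P

module Positions {k : ℕ} (G H : Graph) where

  infixl 5 _[_↦_,_]

  _[_↦_,_] : Position k G H → Fin k → V G → V H → Position k G H
  P [ p ↦ g , g' ] = place {G = G} {H = H} P p g g'

  place-≡ : (P : Position k G H) (p : Fin k) (g : V G) (g' : V H) → (P [ p ↦ g , g' ]) p ≡ just (g , g')
  place-≡ P p g g' with p ≟ p
  ... | yes _  = refl
  ... | no p≢p = contradiction refl p≢p

  place-≢ : (P : Position k G H) {p q : Fin k} (g : V G) (g' : V H) → q ≢ p → (P [ p ↦ g , g' ]) q ≡ P q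
  place-≢ P {p} {q} g g' q≢p with q ≟ p
  ... | yes q≡p = contradiction q≡p q≢p
  ... | no _    = refl

  place-cong : {P Q : Position k G H} → P ≗ Q → ∀ p g g' → P [ p ↦ g , g' ] ≗ Q [ p ↦ g , g' ]
  place-cong P≗Q p g g' q with q ≟ p
  ... | yes _ = refl
  ... | no _  = P≗Q q

  partialIso-cong : {P Q : Position k G H} → P ≗ Q → PartialIso G H P → PartialIso G H Q
  partialIso-cong P≗Q iso p q g g' h h' Qp Qq = iso p q g g' h h' (trans (P≗Q p) Qp) (trans (P≗Q q) Qq)

  spoilerWins-cong : ∀ r {P Q : Position k G H} → P ≗ Q → SpoilerWins G H r P → SpoilerWins G H r Q
  spoilerWins-cong zero    P≗Q ¬iso        = ¬iso ∘ partialIso-cong (sym ∘ P≗Q)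
  spoilerWins-cong (suc r) P≗Q (inj₁ ¬iso) = inj₁ (¬iso ∘ partialIso-cong (sym ∘ P≗Q))
  spoilerWins-cong (suc r) P≗Q (inj₂ (p , inj₁ (g , win))) =
    inj₂ (p , inj₁ (g , λ g' → spoilerWins-cong r (place-cong P≗Q p g g') (win g')))
  spoilerWins-cong (suc r) P≗Q (inj₂ (p , inj₂ (g' , win))) =
    inj₂ (p , inj₂ (g' , λ g → spoilerWins-cong r (place-cong P≗Q p g g') (win g)))

  ¬partialIso⇒spoilerWins : ∀ r {P : Position k G H} → ¬ PartialIso G H P → SpoilerWins G H r P
  ¬partialIso⇒spoilerWins zero    ¬iso = ¬iso
  ¬partialIso⇒spoilerWins (suc r) ¬iso = inj₁ ¬iso

  module _ {P : Position k G H} (iso : PartialIso G H P) {i j : Fin k} {g h : V G} {g' h' : V H}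
           (Pi : P i ≡ just (g , g')) (Pj : P j ≡ just (h , h')) where

    pebbled-≡ : g ≡ h → g' ≡ h'
    pebbled-≡ = proj₁ (proj₁ (iso i j g g' h h' Pi Pj))

    pebbled-≡⁻ : g' ≡ h' → g ≡ h
    pebbled-≡⁻ = proj₂ (proj₁ (iso i j g g' h h' Pi Pj))

    pebbled-edge : Edge G g h → Edge H g' h'
    pebbled-edge = trans (sym (proj₂ (iso i j g g' h h' Pi Pj)))

  swapPosition-involutive : (P : Position k G H) → swapPosition H G (swapPosition G H P) ≗ P
  swapPosition-involutive P q with P q
  ... | just _  = refl
  ... | nothing = refl

  swapPosition-place : (P : Position k G H) (p : Fin k) (g : V G) (g' : V H) →
    swapPosition G H (P [ p ↦ g , g' ]) ≗ place {G = H} {H = G} (swapPosition G H P) p g' g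
  swapPosition-place P p g g' q with q ≟ p
  ... | yes _ = refl
  ... | no _  = refl

  partialIso-swap : (P : Position k G H) → PartialIso G H P → PartialIso H G (swapPosition G H P)
  partialIso-swap P iso p q g' g h' h Pp Pq =
    let (g≡h⇒g'≡h' , g'≡h'⇒g≡h) , adj≡ = iso p q g g' h h' (unswap (P p) Pp) (unswap (P q) Pq)
    in (g'≡h'⇒g≡h , g≡h⇒g'≡h') , sym adj≡
    where
    unswap : ∀ {a b} (m : Maybe (V G × V H)) → Maybe.map swap m ≡ just (b , a) → m ≡ just (a , b)
    unswap (just _) refl = refl

module _ {k : ℕ} {G H : Graph} where

  open Positions {k} G H
  private module Swapped = Positions {k} H G

  ¬partialIso-swap : (P : Position k G H) → ¬ PartialIso G H P → ¬ PartialIso H G (swapPosition G H P)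
  ¬partialIso-swap P ¬iso iso =
    ¬iso (partialIso-cong (swapPosition-involutive P) (Swapped.partialIso-swap _ iso))

  spoilerWins-swap : ∀ r (P : Position k G H) →
    SpoilerWins G H r P → SpoilerWins H G r (swapPosition G H P)
  spoilerWins-swap zero    P ¬iso        = ¬partialIso-swap P ¬iso
  spoilerWins-swap (suc r) P (inj₁ ¬iso) = inj₁ (¬partialIso-swap P ¬iso)
  spoilerWins-swap (suc r) P (inj₂ (p , inj₁ (g , win))) =
    inj₂ (p , inj₂ (g , λ g' →
      Swapped.spoilerWins-cong r (swapPosition-place P p g g') (spoilerWins-swap r _ (win g'))))
  spoilerWins-swap (suc r) P (inj₂ (p , inj₂ (g' , win))) =
    inj₂ (p , inj₁ (g' , λ g →
      Swapped.spoilerWins-cong r (swapPosition-place P p g g') (spoilerWins-swap r _ (win g))))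

spoilerWins-unswap : ∀ {k G H} r {P : Position k G H} {Q : Position k H G} →
  Q ≗ swapPosition G H P → SpoilerWins H G r Q → SpoilerWins G H r P
spoilerWins-unswap {G = G} {H} r {P} Q≗ win =
  spoilerWins-cong r (λ q → trans (cong (Maybe.map swap) (Q≗ q)) (swapPosition-involutive P q))
                     (spoilerWins-swap r _ win)
  where open Positions G H

n≤2*m⇒⌈n/2⌉≤m : ∀ {n m} → n ≤ 2 * m → ⌈ n /2⌉ ≤ m
n≤2*m⇒⌈n/2⌉≤m {n} {m} n≤2m = begin
  ⌈ n /2⌉           ≤⟨ ⌈n/2⌉-mono n≤2m ⟩
  ⌈ m + (m + 0) /2⌉ ≡⟨ cong (λ m′ → ⌈ m + m′ /2⌉) (+-identityʳ m) ⟩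
  ⌈ m + m /2⌉       ≡⟨ sym (n≡⌈n+n/2⌉ m) ⟩
  m                 ∎
  where open ≤-Reasoning

module _ {G : Graph} where

  infixr 5 _++_

  _++_ : ∀ {a b c} → Walk G a b → Walk G b c → Walk G a c
  stop _     ++ w₂ = w₂
  step a e w₁ ++ w₂ = step a e (w₁ ++ w₂)

  len-++ : ∀ {a b c} (w₁ : Walk G a b) (w₂ : Walk G b c) → len (w₁ ++ w₂) ≡ len w₁ + len w₂
  len-++ (stop _)      w₂ = refl
  len-++ (step _ _ w₁) w₂ = cong suc (len-++ w₁ w₂)

  len-≡-++ : ∀ {a b c} {w : Walk G a c} (w₁ : Walk G a b) (w₂ : Walk G b c) →
             w ≡ w₁ ++ w₂ → len w ≡ len w₁ + len w₂
  len-≡-++ w₁ w₂ refl = len-++ w₁ w₂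

  start∈verts : ∀ {a b} (w : Walk G a b) → a ∈ verts w
  start∈verts (stop _)     = here refl
  start∈verts (step _ _ _) = here refl

  junction∈verts : ∀ {a b c} (w₁ : Walk G a b) (w₂ : Walk G b c) → b ∈ verts (w₁ ++ w₂)
  junction∈verts (stop _)      w₂ = start∈verts w₂
  junction∈verts (step _ _ w₁) w₂ = there (junction∈verts w₁ w₂)

  isPath-++ʳ : ∀ {a b c} (w₁ : Walk G a b) (w₂ : Walk G b c) → IsPath (w₁ ++ w₂) → IsPath w₂
  isPath-++ʳ (stop _)      w₂ path       = path
  isPath-++ʳ (step _ _ w₁) w₂ (_ ∷ path) = isPath-++ʳ w₁ w₂ path

  splitAt : ∀ m {l a b} (w : Walk G a b) → len w ≡ m + l →
    ∃ λ c → Σ (Walk G a c) λ w₁ → Σ (Walk G c b) λ w₂ →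
      len w₁ ≡ m × len w₂ ≡ l × w ≡ w₁ ++ w₂
  splitAt zero    w            len≡ = _ , stop _ , w , refl , len≡ , refl
  splitAt (suc m) (step a e w) len≡ =
    let c , w₁ , w₂ , len₁ , len₂ , w≡ = splitAt m w (suc-injective len≡)
    in c , step a e w₁ , w₂ , cong suc len₁ , len₂ , cong (step a e) w≡

  splitAt-∈ : ∀ {a b g} (w : Walk G a b) → g ∈ verts w →
    Σ (Walk G a g) λ w₁ → Σ (Walk G g b) λ w₂ → w ≡ w₁ ++ w₂
  splitAt-∈ (stop _)     (here refl) = stop _ , stop _ , refl
  splitAt-∈ (step _ _ _) (here refl) = stop _ , _ , refl
  splitAt-∈ (step a e w) (there g∈w) =
    let w₁ , w₂ , w≡ = splitAt-∈ w g∈w in step a e w₁ , w₂ , cong (step a e) w≡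

  bisect : ∀ {a b m} (w : Walk G a b) → 2 ≤ len w → len w ≤ 2 * m →
    ∃ λ c → Σ (Walk G a c) λ w₁ → Σ (Walk G c b) λ w₂ →
      w ≡ w₁ ++ w₂ × 0 < len w₁ × 0 < len w₂ × len w₁ ≤ m × len w₂ ≤ m
  bisect (step _ _ (stop _)) (s≤s ()) _
  bisect {m = m} w@(step _ _ (step _ _ _)) _ w≤2m =
    let c , w₁ , w₂ , len₁ , len₂ , w≡ = splitAt ⌊ len w /2⌋ w (sym (⌊n/2⌋+⌈n/2⌉≡n (len w)))
    in c , w₁ , w₂ , w≡ , subst (0 <_) (sym len₁) z<s , subst (0 <_) (sym len₂) z<s ,
       subst (_≤ m) (sym len₁) (≤-trans (⌊n/2⌋≤⌈n/2⌉ (len w)) (n≤2*m⇒⌈n/2⌉≤m w≤2m)) ,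
       subst (_≤ m) (sym len₂) (n≤2*m⇒⌈n/2⌉≤m w≤2m)

module Avoiding (G : Graph) (X : List (V G)) where

  open import Data.List.Membership.DecPropositional (_≟_ {n G}) using (_∈?_)

  -- Avoids w says All (_∉ X) (inner w) (see avoids⇒inner∉ and inner∉⇒avoids); going through
  -- AvoidsInit, which also constrains the first vertex, makes it decompose along _++_.

  AvoidsInit : ∀ {a b} → Walk G a b → Set
  AvoidsInit (stop _)     = ⊤
  AvoidsInit (step a _ w) = a ∉ X × AvoidsInit w

  Avoids : ∀ {a b} → Walk G a b → Set
  Avoids (stop _)     = ⊤
  Avoids (step _ _ w) = AvoidsInit w

  avoids⇒inner∉ : ∀ {a b} (w : Walk G a b) → Avoids w → All (_∉ X) (inner w)
  avoids⇒inner∉ (stop _)                _          = []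
  avoids⇒inner∉ (step _ _ (stop _))     _          = []
  avoids⇒inner∉ (step _ _ (step b e w)) (b∉X , av) = b∉X ∷ avoids⇒inner∉ (step b e w) av

  inner∉⇒avoids : ∀ {a b} (w : Walk G a b) → All (_∉ X) (inner w) → Avoids w
  inner∉⇒avoids (stop _)                _              = tt
  inner∉⇒avoids (step _ _ (stop _))     _              = tt
  inner∉⇒avoids (step _ _ (step b e w)) (b∉X ∷ inner∉) = b∉X , inner∉⇒avoids (step b e w) inner∉

  avoidsInit⇒avoids : ∀ {a b} (w : Walk G a b) → AvoidsInit w → Avoids w
  avoidsInit⇒avoids (stop _)     _         = tt
  avoidsInit⇒avoids (step _ _ _) (_ , av) = av

  avoids⇒avoidsInit : ∀ {a b} (w : Walk G a b) → a ∉ X → Avoids w → AvoidsInit w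
  avoids⇒avoidsInit (stop _)     _   _  = tt
  avoids⇒avoidsInit (step _ _ _) a∉X av = a∉X , av

  avoidsInit-head : ∀ {a b} (w : Walk G a b) → AvoidsInit w → 0 < len w → a ∉ X
  avoidsInit-head (step _ _ _) (a∉X , _) _ = a∉X

  avoidsInit-++⁺ : ∀ {a b c} (w₁ : Walk G a b) (w₂ : Walk G b c) →
    AvoidsInit w₁ → AvoidsInit w₂ → AvoidsInit (w₁ ++ w₂)
  avoidsInit-++⁺ (stop _)      w₂ _          av₂ = av₂
  avoidsInit-++⁺ (step _ _ w₁) w₂ (a∉X , av₁) av₂ = a∉X , avoidsInit-++⁺ w₁ w₂ av₁ av₂

  avoidsInit-++⁻ : ∀ {a b c} (w₁ : Walk G a b) (w₂ : Walk G b c) →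
    AvoidsInit (w₁ ++ w₂) → AvoidsInit w₁ × AvoidsInit w₂
  avoidsInit-++⁻ (stop _)      w₂ av = tt , av
  avoidsInit-++⁻ (step _ _ w₁) w₂ (a∉X , av) =
    let av₁ , av₂ = avoidsInit-++⁻ w₁ w₂ av in (a∉X , av₁) , av₂

  avoids-++⁺ : ∀ {a b c} (w₁ : Walk G a b) (w₂ : Walk G b c) → Avoids w₁ → Avoids w₂ →
    (0 < len w₁ → 0 < len w₂ → b ∉ X) → Avoids (w₁ ++ w₂)
  avoids-++⁺ (stop _)      w₂             _   av₂ _        = av₂
  avoids-++⁺ (step _ _ w₁) (stop _)       av₁ _   _        = avoidsInit-++⁺ w₁ _ av₁ tt
  avoids-++⁺ (step _ _ w₁) (step _ _ w₂) av₁ av₂ junction =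
    avoidsInit-++⁺ w₁ _ av₁ (junction z<s z<s , av₂)

  avoids-++⁻ : ∀ {a b c} (w₁ : Walk G a b) (w₂ : Walk G b c) → Avoids (w₁ ++ w₂) →
    Avoids w₁ × Avoids w₂ × (0 < len w₁ → 0 < len w₂ → b ∉ X)
  avoids-++⁻ (stop _)      w₂ av = tt , av , λ ()
  avoids-++⁻ (step _ _ w₁) w₂ av =
    let av₁ , av₂ = avoidsInit-++⁻ w₁ w₂ av
    in av₁ , avoidsInit⇒avoids w₂ av₂ , λ _ → avoidsInit-head w₂ av₂

  Reachable : ℕ → V G → V G → Set
  Reachable L p q = Σ (Walk G p q) λ w → Avoids w × len w ≤ L

  reachable-++ : ∀ {l m p c q} → Reachable l p c → Reachable m c q → c ∉ X → Reachable (l + m) p q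
  reachable-++ (w₁ , av₁ , w₁≤) (w₂ , av₂ , w₂≤) c∉X =
    w₁ ++ w₂ , avoids-++⁺ w₁ w₂ av₁ av₂ (λ _ _ → c∉X) ,
    subst (_≤ _) (sym (len-++ w₁ w₂)) (+-mono-≤ w₁≤ w₂≤)

  reachable? : ∀ L p q → Dec (Reachable L p q)
  reachable? L p q with p ≟ q
  ... | yes refl = yes (stop p , tt , z≤n)
  reachable? zero p q | no p≢q = no λ where
    (stop _ , _)           → p≢q refl
    (step _ _ _ , _ , ())
  reachable? (suc L) p q | no p≢q =
    map′ viaNeighbour fromNeighbour
      (any? λ b → (adj G p b Bool.≟ true) ×-dec ((b ≟ q) ⊎-dec (¬? (b ∈? X) ×-dec reachable? L b q)))
    where
    Step : V G → Set
    Step b = Edge G p b × (b ≡ q ⊎ (b ∉ X × Reachable L b q))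

    viaNeighbour : ∃ Step → Reachable (suc L) p q
    viaNeighbour (_ , e , inj₁ refl)               = step p e (stop _) , tt , s≤s z≤n
    viaNeighbour (_ , e , inj₂ (b∉X , w , av , w≤)) = step p e w , avoids⇒avoidsInit w b∉X av , s≤s w≤

    fromNeighbour : Reachable (suc L) p q → ∃ Step
    fromNeighbour (stop _ , _)                               = contradiction refl p≢q
    fromNeighbour (step _ e (stop _) , _)                    = _ , e , inj₁ refl
    fromNeighbour (step _ e (step b e′ w) , (b∉X , av) , s≤s w≤) =
      b , e , inj₂ (b∉X , step b e′ w , av , w≤)

  toPath : ∀ {p q} (w : Walk G p q) → Avoids w →
    Σ (Walk G p q) λ w′ → IsPath w′ × Avoids w′ × (w′ ≡ w ⊎ len w′ < len w)
  toPath (stop p) _ = stop p , [] ∷ [] , tt , inj₁ refl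
  toPath (step p e w) av
    with w′ , path , av′ , w′≈w ← toPath w (avoidsInit⇒avoids w av)
    with p ∈? verts w′
  ... | yes p∈w′ =
    -- p already lies on w′, and the part of w′ from p onwards is a shorter path
    let w₁ , w₂ , w′≡ = splitAt-∈ w′ p∈w′
        w₂≤w′ = subst (len w₂ ≤_) (sym (len-≡-++ w₁ w₂ w′≡)) (m≤n+m _ _)
    in w₂ , isPath-++ʳ w₁ w₂ (subst IsPath w′≡ path) ,
       proj₁ (proj₂ (avoids-++⁻ w₁ w₂ (subst Avoids w′≡ av′))) ,
       inj₂ (s≤s (≤-trans w₂≤w′ (shorter w′≈w)))
    where
    shorter : w′ ≡ w ⊎ len w′ < len w → len w′ ≤ len w
    shorter (inj₁ refl) = ≤-refl
    shorter (inj₂ lt)   = <⇒≤ lt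
  ... | no p∉w′ = step p e w′ , ¬Any⇒All¬ (verts w′) p∉w′ ∷ path , avoidsInit w′≈w , extend w′≈w
    where
    avoidsInit : w′ ≡ w ⊎ len w′ < len w → AvoidsInit w′
    avoidsInit (inj₁ refl) = av
    avoidsInit (inj₂ lt)   = avoids⇒avoidsInit w′ (avoidsInit-head w av (≤-<-trans z≤n lt)) av′
    extend : w′ ≡ w ⊎ len w′ < len w → step p e w′ ≡ step p e w ⊎ suc (len w′) < suc (len w)
    extend (inj₁ refl) = inj₁ refl
    extend (inj₂ lt)   = inj₂ (s≤s lt)

module _ {G : Graph} (C : Config G) where

  open Avoiding G (confVerts C)

  short-avoiding-walk⇒InS0 : ∀ {s t d g} → D0 G C s t d → (w : Walk G s t) → Avoids w → len w ≤ d →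
    g ∈ verts w → InS0 G C s t d g
  short-avoiding-walk⇒InS0 (_ , minimal) w av w≤d g∈w with toPath w av
  ... | w′ , path , av′ , inj₁ refl =
    let P = w , path , avoids⇒inner∉ w av in P , ≤-antisym w≤d (minimal P) , g∈w
  ... | w′ , path , av′ , inj₂ w′<w =
    contradiction (minimal (w′ , path , avoids⇒inner∉ w′ av′)) (<⇒≱ (<-≤-trans w′<w w≤d))

module HalvingGame {k : ℕ} (G H : Graph) (X : List (V G)) (X' : List (V H)) (Movable : Fin k → Set)
  where

  open Positions {k} G H
  open Avoiding G X  using (Avoids; avoids-++⁻)
  open Avoiding H X' using (Reachable; reachable?; reachable-++)

  Guarded : Position k G H → Set
  Guarded P = ∀ {c'} → c' ∈ X' → ∃₂ λ l c → ¬ Movable l × P l ≡ just (c , c') × c ∈ X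

  guarded-place : ∀ {P f} → Guarded P → Movable f → ∀ c c' → Guarded (P [ f ↦ c , c' ])
  guarded-place {P} guarded movable c c' c'∈X' =
    let l , d , immovable , Pl , d∈X = guarded c'∈X'
    in l , d , immovable , trans (place-≢ P c c' λ { refl → immovable movable }) Pl , d∈X

  guarded-∉ : ∀ {P p c c'} → Guarded P → PartialIso G H P → P p ≡ just (c , c') → c ∉ X → c' ∉ X'
  guarded-∉ guarded iso Pp c∉X c'∈X' =
    let l , d , _ , Pl , d∈X = guarded c'∈X'
    in c∉X (subst (_∈ X) (pebbled-≡⁻ iso Pl Pp refl) d∈X)

  spoilerWins-halving : ∀ r (P : Position k G H) → Guarded P →
    ∀ {i j f} → Movable i → Movable j → Movable f → i ≢ j → i ≢ f → j ≢ f →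
    ∀ {p q p' q'} → P i ≡ just (p , p') → P j ≡ just (q , q') →
    (w : Walk G p q) → Avoids w → len w ≤ 2 ^ r → ¬ Reachable (len w) p' q' →
    SpoilerWins G H r P
  spoilerWins-halving r P _ _ _ _ _ _ _ {p' = p'} Pi Pj (stop _) _ _ unreachable =
    ¬partialIso⇒spoilerWins r λ iso →
      unreachable (subst (Reachable 0 p') (pebbled-≡ iso Pi Pj refl) (stop p' , tt , z≤n))
  spoilerWins-halving r P _ _ _ _ _ _ _ {p' = p'} {q'} Pi Pj (step _ e (stop _)) _ _ unreachable =
    ¬partialIso⇒spoilerWins r λ iso →
      unreachable (step p' (pebbled-edge iso Pi Pj e) (stop q') , tt , ≤-refl)
  spoilerWins-halving zero P _ _ _ _ _ _ _ _ _ (step _ _ (step _ _ _)) _ (s≤s ()) _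
  spoilerWins-halving (suc r) P guarded {i} {j} {f} mi mj mf i≢j i≢f j≢f {p' = p'} {q'} Pi Pj
    w@(step _ _ (step _ _ _)) av w≤2^r unreachable
    with c , w₁ , w₂ , w≡ , w₁>0 , w₂>0 , w₁≤ , w₂≤ ← bisect w (s≤s (s≤s z≤n)) w≤2^r
    with av₁ , av₂ , junction ← avoids-++⁻ w₁ w₂ (subst Avoids w≡ av)
    = inj₂ (f , inj₁ (c , respond))
    where
    respond : ∀ c' → SpoilerWins G H r (P [ f ↦ c , c' ])
    respond c' with reachable? (len w₁) p' c' | reachable? (len w₂) c' q'
    ... | no ¬reach₁ | _ =
      spoilerWins-halving r _ (guarded-place guarded mf c c') mi mf mj i≢f i≢j (≢-sym j≢f)
        (trans (place-≢ P c c' i≢f) Pi) (place-≡ P f c c') w₁ av₁ w₁≤ ¬reach₁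
    ... | yes _ | no ¬reach₂ =
      spoilerWins-halving r _ (guarded-place guarded mf c c') mf mj mi (≢-sym j≢f) (≢-sym i≢f) (≢-sym i≢j)
        (place-≡ P f c c') (trans (place-≢ P c c' j≢f) Pj) w₂ av₂ w₂≤ ¬reach₂
    ... | yes reach₁ | yes reach₂ =
      ¬partialIso⇒spoilerWins r λ iso →
        let c'∉X' = guarded-∉ {p = f} (guarded-place guarded mf c c') iso (place-≡ P f c c')
                              (junction w₁>0 w₂>0)
        in unreachable (subst (λ L → Reachable L p' q') (sym (len-≡-++ w₁ w₂ w≡))
                              (reachable-++ reach₁ reach₂ c'∉X'))

module _ {k : ℕ} (G H : Graph) (C : Config G) (C' : Config H) (Movable : Fin k → Set) where

  open HalvingGame G H (confVerts C) (confVerts C') Movable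
  open Positions {k} G H using (¬partialIso⇒spoilerWins)
  open Avoiding G (confVerts C)  using (Avoids; inner∉⇒avoids; avoids-++⁻)
  open Avoiding H (confVerts C') using (reachable?; avoids-++⁺)

  spoilerWins-S₀ : ∀ r (P : Position k G H) → Guarded P →
    ∀ {i j f} → Movable i → Movable j → Movable f → i ≢ j → i ≢ f → j ≢ f →
    ∀ {s t a s' t' a' d} → P i ≡ just (s , s') → P j ≡ just (t , t') → P f ≡ just (a , a') →
    d ≤ 2 ^ r → D0 H C' s' t' d → InS0 G C s t d a → ¬ InS0 H C' s' t' d a' →
    SpoilerWins G H r P
  spoilerWins-S₀ r P guarded mi mj mf i≢j i≢f j≢f {s' = s'} {t'} {a'} {d} Ps Pt Pa d≤2^r D0′
    ((path , _ , inner∉) , path≡d , a∈path) a'∉S₀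
    with w₁ , w₂ , path≡ ← splitAt-∈ path a∈path
    with av₁ , av₂ , junction ← avoids-++⁻ w₁ w₂ (subst Avoids path≡ (inner∉⇒avoids path inner∉))
    with w₁+w₂≡d ← trans (sym (len-≡-++ w₁ w₂ path≡)) path≡d
    with reachable? (len w₁) s' a' | reachable? (len w₂) a' t'
  ... | no ¬reach₁ | _ =
    spoilerWins-halving r P guarded mi mf mj i≢f i≢j (≢-sym j≢f) Ps Pa w₁ av₁
      (≤-trans (m≤m+n (len w₁) (len w₂)) (subst (_≤ 2 ^ r) (sym w₁+w₂≡d) d≤2^r)) ¬reach₁
  ... | yes _ | no ¬reach₂ =
    spoilerWins-halving r P guarded mf mj mi (≢-sym j≢f) (≢-sym i≢f) (≢-sym i≢j) Pa Pt w₂ av₂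
      (≤-trans (m≤n+m (len w₂) (len w₁)) (subst (_≤ 2 ^ r) (sym w₁+w₂≡d) d≤2^r)) ¬reach₂
  ... | yes (v₁ , av₁′ , v₁≤) | yes (v₂ , av₂′ , v₂≤) =
    ¬partialIso⇒spoilerWins r λ iso →
      let a'∉X' v₁>0 v₂>0 =
            guarded-∉ guarded iso Pa (junction (<-≤-trans v₁>0 v₁≤) (<-≤-trans v₂>0 v₂≤))
      in a'∉S₀ (short-avoiding-walk⇒InS0 C' D0′ (v₁ ++ v₂) (avoids-++⁺ v₁ v₂ av₁′ av₂′ a'∉X')
                 v≤d (junction∈verts v₁ v₂))
    where
    v≤d : len (v₁ ++ v₂) ≤ d
    v≤d = begin
      len (v₁ ++ v₂)  ≡⟨ len-++ v₁ v₂ ⟩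
      len v₁ + len v₂ ≤⟨ +-mono-≤ v₁≤ v₂≤ ⟩
      len w₁ + len w₂ ≡⟨ w₁+w₂≡d ⟩
      d               ∎
      where open ≤-Reasoning

data Movable : Fin 9 → Set where
  s-pebble : Movable (# 6)
  t-pebble : Movable (# 7)
  a-pebble : Movable (# 8)

module _ {G H : Graph} (C : Config G) (C' : Config H) (s t a : V G) (s' t' a' : V H) where

  startPos-guarded :
    HalvingGame.Guarded G H (confVerts C) (confVerts C') Movable (startPos C C' s t a s' t' a')
  startPos-guarded (here refl) =
    # 0 , x C , (λ ()) , refl , here refl
  startPos-guarded (there (here refl)) =
    # 1 , y C , (λ ()) , refl , there (here refl)
  startPos-guarded (there (there (here refl))) =
    # 2 , z C , (λ ()) , refl , there (there (here refl))
  startPos-guarded (there (there (there (here refl)))) =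
    # 3 , u C , (λ ()) , refl , there (there (there (here refl)))
  startPos-guarded (there (there (there (there (here refl))))) =
    # 4 , v C , (λ ()) , refl , there (there (there (there (here refl))))
  startPos-guarded (there (there (there (there (there (here refl)))))) =
    # 5 , w C , (λ ()) , refl , there (there (there (there (there (here refl)))))

  startPos-swap : startPos C' C s' t' a' s t a ≗ swapPosition G H (startPos C C' s t a s' t' a')
  startPos-swap zero                                                 = refl
  startPos-swap (suc zero)                                           = refl
  startPos-swap (suc (suc zero))                                     = refl
  startPos-swap (suc (suc (suc zero)))                               = refl
  startPos-swap (suc (suc (suc (suc zero))))                         = refl
  startPos-swap (suc (suc (suc (suc (suc zero)))))                   = refl
  startPos-swap (suc (suc (suc (suc (suc (suc zero))))))             = refl
  startPos-swap (suc (suc (suc (suc (suc (suc (suc zero)))))))       = refl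
  startPos-swap (suc (suc (suc (suc (suc (suc (suc (suc zero)))))))) = refl

Unique⇒length≤ : ∀ {m} (xs : List (Fin m)) → Unique xs → length xs ≤ m
Unique⇒length≤ {m} xs unique with length xs ≤? m
... | yes ≤m = ≤m
... | no ≰m with i , j , i<j , xsᵢ≡xsⱼ ← pigeonhole (≰⇒> ≰m) (lookup xs) =
  contradiction xsᵢ≡xsⱼ (lookup-injective xs unique i<j)
  where
  lookup-injective : ∀ (xs : List (Fin m)) → Unique xs →
    ∀ {i j} → toℕ i < toℕ j → lookup xs i ≢ lookup xs j
  lookup-injective (_ ∷ xs) (x∉xs ∷ _)   {zero}  {suc j} _         = All.lookup x∉xs (∈-lookup j)
  lookup-injective (_ ∷ xs) (_ ∷ unique) {suc i} {suc j} (s≤s i<j) = lookup-injective xs unique i<j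

isPath⇒len<n : ∀ {G a b} (w : Walk G a b) → IsPath w → len w < n G
isPath⇒len<n w path = subst (_≤ _) (length-verts w) (Unique⇒length≤ (verts w) path)
  where
  length-verts : ∀ {G a b} (w : Walk G a b) → length (verts w) ≡ suc (len w)
  length-verts (stop _)     = refl
  length-verts (step _ _ w) = cong suc (length-verts w)

n<2^[1+⌊log₂n⌋] : ∀ m → m < 2 ^ suc ⌊log₂ m ⌋
n<2^[1+⌊log₂n⌋] m with m <? 2 ^ suc ⌊log₂ m ⌋
... | yes m< = m<
... | no m≮ =
  contradiction (subst (_≤ ⌊log₂ m ⌋) (⌊log₂[2^n]⌋≡n _) (⌊log₂⌋-mono-≤ (≮⇒≥ m≮))) 1+n≰n

D0⇒d≤2^[⌊log₂n⌋+2] : ∀ {G C s t d} → D0 G C s t d → d ≤ 2 ^ (⌊log₂ n G ⌋ + 2)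
D0⇒d≤2^[⌊log₂n⌋+2] {G} {d = d} (((path , isPath , _) , path≡d) , _) = begin
  d                     ≡⟨ sym path≡d ⟩
  len path              <⟨ isPath⇒len<n path isPath ⟩
  n G                   <⟨ n<2^[1+⌊log₂n⌋] (n G) ⟩
  2 ^ suc ⌊log₂ n G ⌋   ≤⟨ ^-monoʳ-≤ 2 (m≤n+m (suc ⌊log₂ n G ⌋) 1) ⟩
  2 ^ (2 + ⌊log₂ n G ⌋) ≡⟨ cong (2 ^_) (+-comm 2 ⌊log₂ n G ⌋) ⟩
  2 ^ (⌊log₂ n G ⌋ + 2) ∎
  where open ≤-Reasoning

lemma8 : (G G' : Graph) → ¬ Iso G G' →
    Triconnected G → Triconnected G' →
    (ρ : Rotation G) → IsPlanarEmbedding G ρ →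
    (ρ' : Rotation G') → IsPlanarEmbedding G' ρ' →
    (C : Config G) → Collocated G ρ C →
    (C' : Config G') → Twisted G' ρ' C' →
    (s t a : V G) → (s' t' a' : V G') →
    (d : ℕ) → D0 G C s t d → D0 G' C' s' t' d →
    ((InS0 G C s t d a × ¬ InS0 G' C' s' t' d a') ⊎
     (¬ InS0 G C s t d a × InS0 G' C' s' t' d a')) →
    SpoilerWins G G' (⌊log₂ n G ⌋ + 2) (startPos C C' s t a s' t' a')
lemma8 G G' _ _ _ _ _ _ _ C _ C' _ s t a s' t' a' d D0 D0′ =
  [ (λ (a∈S₀ , a'∉S₀′) →
      spoilerWins-S₀ G G' C C' Movable r _ (startPos-guarded C C' s t a s' t' a')
        s-pebble t-pebble a-pebble (λ ()) (λ ()) (λ ()) refl refl refl d≤2^r D0′ a∈S₀ a'∉S₀′)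
  , (λ (a∉S₀ , a'∈S₀′) →
      spoilerWins-unswap r (startPos-swap C C' s t a s' t' a')
        (spoilerWins-S₀ G' G C' C Movable r _ (startPos-guarded C' C s' t' a' s t a)
          s-pebble t-pebble a-pebble (λ ()) (λ ()) (λ ()) refl refl refl d≤2^r D0 a'∈S₀′ a∉S₀))
  ]′
  where
  r : ℕ
  r = ⌊log₂ n G ⌋ + 2

  d≤2^r : d ≤ 2 ^ r
  d≤2^r = D0⇒d≤2^[⌊log₂n⌋+2] D0
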